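{- Let $f,g\in\mathbb{F}[x_1,\dots,x_n]$, where $f$ has degree $d$ and $\mathbb{F}$ has characteristic zero or characteristic greater than $d$. If $\mathbf a\in\mathcal S_{f,g}$ and $\mathbf b\in\mathbb{F}^n$, then $\mathbf b\in\mathcal S_{f,g}$ if and only if $f^{(1)}(\mathbf a,\mathbf x)\equiv f^{(1)}(\mathbf b,\mathbf x)$. Consequently, $\mathbf b\in\mathcal S_{f,g}$ if and only if $f_i^{(1)}(\mathbf b,\mathbf x)\equiv f_i^{(1)}(\mathbf a,\mathbf x)$ for all $0\le i\le d$.
   Context: $\mathcal S_{f,g}=\{\mathbf b\in\mathbb{F}^n: f(\mathbf x+\mathbf b)\equiv g(\mathbf x)\}$. $f^{(1)}(\mathbf a,\mathbf x)=\sum_{t=1}^n a_t\,\frac{\partial f}{\partial x_t}(\mathbf x)$ and $f_i^{(1)}(\mathbf a,\mathbf x)=\sum_{t=1}^n a_t\,\frac{\partial H^i(f)}{\partial x_t}(\mathbf x)$, where $H^i(f)$ is the homogeneous component of degree $i$ of $f$ (formal partial derivatives). $\equiv$ denotes identity of polynomials. -}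

module Defs where

open import Level using (Level; _⊔_)
open import Algebra.Bundles using (CommutativeRing)
open import Data.Nat as ℕ using (ℕ; zero; suc; _≤_; _<_; _∸_)
open import Data.Nat.Combinatorics using (_C_)
open import Data.Fin using (Fin; zero; suc)
open import Data.Vec using (Vec; []; _∷_; lookup; _[_]%=_; foldr)
open import Data.Product using (Σ; ∃; _×_; _,_)
open import Data.Sum using (_⊎_)
open import Relation.Nullary using (¬_; yes; no)
open import Relation.Binary.PropositionalEquality using (_≡_)
open import Function.Bundles using (_⇔_)

record Field (c ℓ : Level) : Set (Level.suc (c ⊔ ℓ)) where
  field
    commutativeRing : CommutativeRing c ℓ
  open CommutativeRing commutativeRing public
  field
    1≉0     : ¬ (1# ≈ 0#)
    inverse : ∀ x → ¬ (x ≈ 0#) → ∃ λ y → x * y ≈ 1#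

-- Multi-indices (exponent vectors) in n variables and their total degree.
Mono : ℕ → Set
Mono n = Vec ℕ n

∣_∣ₘ : ∀ {n} → Mono n → ℕ
∣ α ∣ₘ = foldr _ ℕ._+_ 0 α

module PolyDefs {c ℓ} (F : Field c ℓ) where
  open Field F public hiding (zero)

  ι : ℕ → Carrier
  ι zero    = 0#
  ι (suc k) = 1# + ι k

  pow : Carrier → ℕ → Carrier
  pow x zero    = 1#
  pow x (suc k) = x * pow x k

  CharZero : Set ℓ
  CharZero = ∀ k → ¬ (ι (suc k) ≈ 0#)

  CharGreaterThan : ℕ → Set ℓ
  CharGreaterThan d = Σ ℕ λ p → d < p × ι p ≈ 0# × (∀ k → 0 < k → k < p → ¬ (ι k ≈ 0#))

  sumFin : ∀ n → (Fin n → Carrier) → Carrier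
  sumFin zero    h = 0#
  sumFin (suc n) h = h zero + sumFin n (λ i → h (suc i))

  sumUpTo : ℕ → (ℕ → Carrier) → Carrier
  sumUpTo zero    h = h 0
  sumUpTo (suc B) h = h (suc B) + sumUpTo B h

  sumBox : ∀ n → ℕ → (Mono n → Carrier) → Carrier
  sumBox zero    B h = h []
  sumBox (suc n) B h = sumUpTo B (λ k → sumBox n B (λ β → h (k ∷ β)))

  prodFin : ∀ n → (Fin n → Carrier) → Carrier
  prodFin zero    h = 1#
  prodFin (suc n) h = h zero * prodFin n (λ i → h (suc i))

  -- A polynomial in F[x_1,…,x_n], given by its coefficient function
  -- (coefficient of x^α), together with a bound on its total degree
  -- guaranteeing finite support.
  record Poly (n : ℕ) : Set (c ⊔ ℓ) where
    field
      coeff  : Mono n → Carrier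
      bound  : ℕ
      vanish : ∀ α → bound < ∣ α ∣ₘ → coeff α ≈ 0#
  open Poly public

  _≡ₚ_ : ∀ {n} → Poly n → Poly n → Set ℓ
  f ≡ₚ g = ∀ α → coeff f α ≈ coeff g α

  HasDegree : ∀ {n} → Poly n → ℕ → Set ℓ
  HasDegree f d = (∀ α → d < ∣ α ∣ₘ → coeff f α ≈ 0#)
                × (Σ (Mono _) λ α → ∣ α ∣ₘ ≡ d × ¬ (coeff f α ≈ 0#))

  -- coefficients of the translate f(x + b):
  --   f(x+b) = Σ_β c_β Π_i (x_i + b_i)^{β_i}
  --          = Σ_β c_β Π_i Σ_{α_i} (β_i choose α_i) b_i^{β_i - α_i} x_i^{α_i}
  shiftCoeff : ∀ {n} → Poly n → Vec Carrier n → Mono n → Carrier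
  shiftCoeff {n} f b α =
    sumBox n (bound f) (λ β →
      coeff f β * prodFin n (λ i →
        ι (lookup β i C lookup α i) * pow (lookup b i) (lookup β i ∸ lookup α i)))

  -- f(x + b) is an exact polynomial identity with g(x)
  -- S_{f,g} membership: b ∈ S f g
  _∈S[_,_] : ∀ {n} → Vec Carrier n → Poly n → Poly n → Set ℓ
  b ∈S[ f , g ] = ∀ α → shiftCoeff f b α ≈ coeff g α

  -- We work with coefficient functions for the derived polynomials
  -- (their finite support is inherited from f, but is not needed below).
  Coeffs : ℕ → Set c
  Coeffs n = Mono n → Carrier

  _≡ᶜ_ : ∀ {n} → Coeffs n → Coeffs n → Set ℓ
  p ≡ᶜ q = ∀ α → p α ≈ q α

  ∂ : ∀ {n} → Fin n → Coeffs n → Coeffs n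
  ∂ t p α = ι (suc (lookup α t)) * p (α [ t ]%= suc)

  H : ∀ {n} → ℕ → Coeffs n → Coeffs n
  H i p α with ∣ α ∣ₘ ℕ.≟ i
  ... | yes _ = p α
  ... | no  _ = 0#

  D¹ : ∀ {n} → Vec Carrier n → Coeffs n → Coeffs n
  D¹ {n} a p α = sumFin n (λ t → lookup a t * ∂ t p α)

  f¹ : ∀ {n} → Poly n → Vec Carrier n → Coeffs n
  f¹ f a = D¹ a (coeff f)

  f¹[_] : ∀ {n} → ℕ → Poly n → Vec Carrier n → Coeffs n
  f¹[ i ] f a = D¹ a (H i (coeff f))

module Submission where

-- The translate f(x + b) splits into parts P_k(b), homogeneous of degree k
-- in b (Taylor expansion): f(x + b) = Σ_k P_k(b), P_0(b) = f,
-- (k+1)·P_{k+1}(b) = D_b P_k(b) with D_b = Σ_t b_t ∂_t, and P_k(b) = 0 for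
-- k > d = deg f.  The recursion comes from an Euler identity for the
-- coefficients of Π_i (x_i + b_i)^{β_i}; as 1, …, d are invertible in F it
-- determines P_{k+1}.
-- Module Rigidity compares a and b: if D_a f and D_b f agree in all degrees
-- ≥ m, so do all P_k(a) and P_k(b); with m = 0 this gives f(x+a) = f(x+b).
-- Conversely, if f(x+a) = f(x+b), downward induction on m shows that D_a f
-- and D_b f agree in degrees ≥ m: in degree m all parts but P_1 = D f are
-- already known to agree.  Homogeneous components follow since D_e H^i(f)
-- is the degree i - 1 part of D_e f (module Bounded).

open import Defs
open import Level using (Level; _⊔_)
open import Data.Nat using (ℕ; _≤_)
open import Data.Vec using (Vec)
open import Data.Product using (_×_)
open import Data.Sum using (_⊎_)
open import Function.Bundles using (_⇔_; mk⇔)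

open import Data.Nat
  using (zero; suc; _<_; _∸_; z≤n; s≤s; _≟_; _<?_; _≤?_)
  renaming (_+_ to _+ℕ_; _*_ to _*ℕ_)
import Data.Nat.Properties as ℕₚ
open import Data.Nat.Properties
  using ( <-cmp; +-suc; +-cancelˡ-≡; ≤-refl; ≤-trans
        ; <⇒≤; n≤1+n; m≤n⇒m≤1+n; ≤∧≢⇒<; ≤-pred; <-irrefl; ≮⇒≥; ≰⇒>
        ; <-≤-trans; ≤-<-trans; m≤m+n; m≤n+m; +-mono-≤; +-mono-<-≤
        ; m+[n∸m]≡n; m+n∸m≡n; m∸n≤m; n∸n≡0; +-∸-assoc)
open import Data.Nat.Combinatorics
  using (_C_; nC1≡n; nCn≡1; k>n⇒nCk≡0; nCk+nC[k+1]≡[n+1]C[k+1])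
open import Data.Nat.Tactic.RingSolver using (solve-∀)
open import Data.Fin as Fin using (Fin; zero; suc)
open import Data.Vec using ([]; _∷_; lookup; _[_]%=_)
open import Data.Vec.Properties using (∷-injectiveˡ; ∷-injectiveʳ; updateAt-commutes; lookup∘updateAt′)
open import Data.Product using (_,_)
open import Data.Sum using (inj₁; inj₂)
open import Function.Base using (_∘_)
open import Relation.Nullary using (¬_; yes; no; contradiction)
open import Relation.Binary.PropositionalEquality as ≡ using (_≡_; _≢_)
open import Relation.Binary.Definitions using (tri<; tri≈; tri>)
import Function.Properties.Equivalence as ⇔

absorption : ∀ m a → a *ℕ (m C a) +ℕ suc a *ℕ (m C suc a) ≡ m *ℕ (m C a)
absorption zero zero = ≡.cong (_+ℕ 0) (k>n⇒nCk≡0 {0} {1} (s≤s z≤n))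
absorption zero (suc a)
  rewrite k>n⇒nCk≡0 {0} {suc a} (s≤s z≤n) | k>n⇒nCk≡0 {0} {suc (suc a)} (s≤s z≤n)
        | ℕₚ.*-zeroʳ a = ≡.refl
absorption (suc m) zero =
  ≡.trans (ℕₚ.+-identityʳ (suc m C 1)) (≡.trans (nC1≡n (suc m)) (≡.sym (ℕₚ.*-identityʳ (suc m))))
absorption (suc m) (suc a) = begin
    suc a *ℕ (suc m C suc a) +ℕ suc (suc a) *ℕ (suc m C suc (suc a))
  ≡⟨ ≡.cong₂ (λ u v → suc a *ℕ u +ℕ suc (suc a) *ℕ v) (≡.sym (pascal a)) (≡.sym (pascal (suc a))) ⟩
    suc a *ℕ (p +ℕ q) +ℕ suc (suc a) *ℕ (q +ℕ r)
  ≡⟨ regroup a p q r ⟩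
    (p +ℕ (a *ℕ p +ℕ suc a *ℕ q)) +ℕ (q +ℕ (suc a *ℕ q +ℕ suc (suc a) *ℕ r))
  ≡⟨ ≡.cong₂ (λ u v → (p +ℕ u) +ℕ (q +ℕ v)) (absorption m a) (absorption m (suc a)) ⟩
    (p +ℕ m *ℕ p) +ℕ (q +ℕ m *ℕ q)
  ≡⟨ collect m p q ⟩
    suc m *ℕ (p +ℕ q)
  ≡⟨ ≡.cong (suc m *ℕ_) (pascal a) ⟩
    suc m *ℕ (suc m C suc a)
  ∎
  where
  open ≡.≡-Reasoning
  p q r : ℕ
  p = m C a
  q = m C suc a
  r = m C suc (suc a)
  pascal : ∀ k → m C k +ℕ m C suc k ≡ suc m C suc k
  pascal = nCk+nC[k+1]≡[n+1]C[k+1] m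
  regroup : ∀ a p q r → suc a *ℕ (p +ℕ q) +ℕ suc (suc a) *ℕ (q +ℕ r)
                      ≡ (p +ℕ (a *ℕ p +ℕ suc a *ℕ q)) +ℕ (q +ℕ (suc a *ℕ q +ℕ suc (suc a) *ℕ r))
  regroup = solve-∀
  collect : ∀ m p q → (p +ℕ m *ℕ p) +ℕ (q +ℕ m *ℕ q) ≡ suc m *ℕ (p +ℕ q)
  collect = solve-∀

tail-< : ∀ {m x a y} → m +ℕ x < a +ℕ y → a ≤ m → x < y
tail-< {m} {x} {a} {y} lt a≤m with x <? y
... | yes x<y = x<y
... | no x≮y = contradiction (≤-<-trans (+-mono-≤ a≤m (≮⇒≥ x≮y)) lt) (<-irrefl ≡.refl)

tail-≡ : ∀ {m x a y} → m +ℕ x ≡ a +ℕ y → a < m → x < y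
tail-≡ {m} {x} {a} {y} e a<m with x <? y
... | yes x<y = x<y
... | no x≮y = contradiction (+-mono-<-≤ a<m (≮⇒≥ x≮y)) (<-irrefl (≡.sym e))

∣inc∣ : ∀ {n} (α : Mono n) t → ∣ α [ t ]%= suc ∣ₘ ≡ suc ∣ α ∣ₘ
∣inc∣ (a ∷ α) zero    = ≡.refl
∣inc∣ (a ∷ α) (suc t) = ≡.trans (≡.cong (a +ℕ_) (∣inc∣ α t)) (+-suc a ∣ α ∣ₘ)

lookup≤∣∣ : ∀ {n} (α : Mono n) i → lookup α i ≤ ∣ α ∣ₘ
lookup≤∣∣ (a ∷ α) zero    = m≤m+n a ∣ α ∣ₘ
lookup≤∣∣ (a ∷ α) (suc i) = ≤-trans (lookup≤∣∣ α i) (m≤n+m ∣ α ∣ₘ a)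

module Theory {c ℓ} (F : Field c ℓ) where
  open PolyDefs F
  open import Relation.Binary.Reasoning.Setoid setoid
  open import Algebra.Properties.AbelianGroup +-abelianGroup using (∙-cancelˡ; ∙-cancelʳ)
  open import Algebra.Properties.CommutativeSemigroup *-commutativeSemigroup using (x∙yz≈y∙xz)
  open import Algebra.Solver.Ring.NaturalCoefficients.Default commutativeSemiring
    using (solve; _:=_; _:+_; _:*_)

  ι-+ : ∀ m n → ι (m +ℕ n) ≈ ι m + ι n
  ι-+ zero    n = sym (+-identityˡ (ι n))
  ι-+ (suc m) n = trans (+-congˡ (ι-+ m n)) (sym (+-assoc 1# (ι m) (ι n)))

  ι-* : ∀ m n → ι (m *ℕ n) ≈ ι m * ι n
  ι-* zero    n = sym (zeroˡ (ι n))
  ι-* (suc m) n = begin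
    ι (n +ℕ m *ℕ n)       ≈⟨ ι-+ n (m *ℕ n) ⟩
    ι n + ι (m *ℕ n)      ≈⟨ +-cong (sym (*-identityˡ (ι n))) (ι-* m n) ⟩
    1# * ι n + ι m * ι n  ≈⟨ sym (distribʳ (ι n) 1# (ι m)) ⟩
    (1# + ι m) * ι n      ∎

  ι-one : ι 1 ≈ 1#
  ι-one = +-identityʳ 1#

  pull-out : ∀ x y z w → y * (z * (x * w)) ≈ x * (y * (z * w))
  pull-out x y z w = trans (*-congˡ (x∙yz≈y∙xz z x w)) (x∙yz≈y∙xz y x (z * w))

  *-cancelˡ-nonzero : ∀ {z x y} → ¬ (z ≈ 0#) → z * x ≈ z * y → x ≈ y
  *-cancelˡ-nonzero {z} {x} {y} z≉0 zx≈zy with inverse z z≉0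
  ... | w , zw≈1 = begin
    x              ≈⟨ sym (*-identityˡ x) ⟩
    1# * x         ≈⟨ *-congʳ (sym zw≈1) ⟩
    (z * w) * x    ≈⟨ swap x ⟩
    w * (z * x)    ≈⟨ *-congˡ zx≈zy ⟩
    w * (z * y)    ≈⟨ sym (swap y) ⟩
    (z * w) * y    ≈⟨ *-congʳ zw≈1 ⟩
    1# * y         ≈⟨ *-identityˡ y ⟩
    y              ∎
    where
    swap : ∀ u → (z * w) * u ≈ w * (z * u)
    swap u = trans (*-congʳ (*-comm z w)) (*-assoc w z u)

  ι-nonzero : ∀ {d} → CharZero ⊎ CharGreaterThan d → ∀ k → suc k ≤ d → ¬ (ι (suc k) ≈ 0#)
  ι-nonzero (inj₁ char0)             k _   = char0 k
  ι-nonzero (inj₂ (p , d<p , _ , h)) k k<d = h (suc k) (s≤s z≤n) (≤-<-trans k<d d<p)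

  record IsLinearSum {a} {A : Set a} (S : (A → Carrier) → Carrier) : Set (a ⊔ c ⊔ ℓ) where
    field
      cong     : ∀ {h h′} → (∀ i → h i ≈ h′ i) → S h ≈ S h′
      additive : ∀ h h′ → S (λ i → h i + h′ i) ≈ S h + S h′
      scalar   : ∀ x h → S (λ i → x * h i) ≈ x * S h

    sum-of-zeros : ∀ {h} → (∀ i → h i ≈ 0#) → S h ≈ 0#
    sum-of-zeros {h} h≈0 = begin
      S h                   ≈⟨ cong (λ i → trans (h≈0 i) (sym (zeroˡ 0#))) ⟩
      S (λ _ → 0# * 0#)     ≈⟨ scalar 0# (λ _ → 0#) ⟩
      0# * S (λ _ → 0#)     ≈⟨ zeroˡ _ ⟩
      0#                    ∎
  open IsLinearSum

  +-interchange : ∀ a b c d → (a + b) + (c + d) ≈ (a + c) + (b + d)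
  +-interchange = solve 4 (λ a b c d → ((a :+ b) :+ (c :+ d)) := ((a :+ c) :+ (b :+ d))) refl

  sumFin-linear : ∀ n → IsLinearSum (sumFin n)
  cong     (sumFin-linear zero)    _ = refl
  cong     (sumFin-linear (suc n)) e = +-cong (e zero) (cong (sumFin-linear n) (e ∘ suc))
  additive (sumFin-linear zero)    _ _ = sym (+-identityʳ 0#)
  additive (sumFin-linear (suc n)) h h′ =
    trans (+-congˡ (additive (sumFin-linear n) _ _)) (+-interchange _ _ _ _)
  scalar   (sumFin-linear zero)    x _ = sym (zeroʳ x)
  scalar   (sumFin-linear (suc n)) x h =
    trans (+-congˡ (scalar (sumFin-linear n) x _)) (sym (distribˡ x _ _))

  sumUpTo-linear : ∀ K → IsLinearSum (sumUpTo K)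
  cong     (sumUpTo-linear zero)    e = e 0
  cong     (sumUpTo-linear (suc K)) e = +-cong (e (suc K)) (cong (sumUpTo-linear K) e)
  additive (sumUpTo-linear zero)    _ _ = refl
  additive (sumUpTo-linear (suc K)) h h′ =
    trans (+-congˡ (additive (sumUpTo-linear K) h h′)) (+-interchange _ _ _ _)
  scalar   (sumUpTo-linear zero)    _ _ = refl
  scalar   (sumUpTo-linear (suc K)) x h =
    trans (+-congˡ (scalar (sumUpTo-linear K) x h)) (sym (distribˡ x _ _))

  sumBox-linear : ∀ n B → IsLinearSum (sumBox n B)
  cong     (sumBox-linear zero    B) e = e []
  cong     (sumBox-linear (suc n) B) e =
    cong (sumUpTo-linear B) (λ k → cong (sumBox-linear n B) (λ β → e (k ∷ β)))
  additive (sumBox-linear zero    B) _ _ = refl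
  additive (sumBox-linear (suc n) B) h h′ =
    trans (cong (sumUpTo-linear B) (λ k → additive (sumBox-linear n B) _ _))
          (additive (sumUpTo-linear B) _ _)
  scalar   (sumBox-linear zero    B) _ _ = refl
  scalar   (sumBox-linear (suc n) B) x h =
    trans (cong (sumUpTo-linear B) (λ k → scalar (sumBox-linear n B) x _))
          (scalar (sumUpTo-linear B) x _)

  sumFin-swap : ∀ {a} {A : Set a} {S} → IsLinearSum {A = A} S →
                ∀ m (h : Fin m → A → Carrier) →
                sumFin m (λ t → S (h t)) ≈ S (λ i → sumFin m (λ t → h t i))
  sumFin-swap L zero    h = sym (sum-of-zeros L (λ _ → refl))
  sumFin-swap L (suc m) h = trans (+-congˡ (sumFin-swap L m (h ∘ suc))) (sym (additive L _ _))

  sumUpTo-swap : ∀ {a} {A : Set a} {S} → IsLinearSum {A = A} S →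
                 ∀ K (h : ℕ → A → Carrier) →
                 sumUpTo K (λ k → S (h k)) ≈ S (λ i → sumUpTo K (λ k → h k i))
  sumUpTo-swap L zero    h = refl
  sumUpTo-swap L (suc K) h = trans (+-congˡ (sumUpTo-swap L K h)) (sym (additive L _ _))

  sumUpTo-congBelow : ∀ K {h h′} → (∀ k → k ≤ K → h k ≈ h′ k) → sumUpTo K h ≈ sumUpTo K h′
  sumUpTo-congBelow zero    e = e 0 z≤n
  sumUpTo-congBelow (suc K) e = +-cong (e (suc K) ≤-refl) (sumUpTo-congBelow K (λ k → e k ∘ m≤n⇒m≤1+n))

  sumUpTo-single : ∀ K r {h} → (∀ k → k ≢ r → h k ≈ 0#) → r ≤ K → sumUpTo K h ≈ h r
  sumUpTo-single zero    .zero _ z≤n = refl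
  sumUpTo-single (suc K) r {h} off r≤K with r ≟ suc K
  ... | yes ≡.refl = begin
    h (suc K) + sumUpTo K h             ≈⟨ +-congˡ (sumUpTo-congBelow K below) ⟩
    h (suc K) + sumUpTo K (λ _ → 0#)    ≈⟨ +-congˡ (sum-of-zeros (sumUpTo-linear K) (λ _ → refl)) ⟩
    h (suc K) + 0#                      ≈⟨ +-identityʳ _ ⟩
    h (suc K)                           ∎
    where
    below : ∀ k → k ≤ K → h k ≈ 0#
    below k k≤K = off k (λ k≡r → <-irrefl k≡r (s≤s k≤K))
  ... | no r≢K = begin
    h (suc K) + sumUpTo K h   ≈⟨ +-cong (off (suc K) (r≢K ∘ ≡.sym)) (sumUpTo-single K r off (≤-pred (≤∧≢⇒< r≤K r≢K))) ⟩
    0# + h r                  ≈⟨ +-identityˡ _ ⟩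
    h r                       ∎

  sumUpTo-cancel : ∀ K r {h h′} → r ≤ K → sumUpTo K h ≈ sumUpTo K h′ →
                   (∀ k → k ≢ r → h k ≈ h′ k) → h r ≈ h′ r
  sumUpTo-cancel zero    .zero z≤n sum≈ _ = sum≈
  sumUpTo-cancel (suc K) r {h} {h′} r≤K sum≈ off with r ≟ suc K
  ... | yes ≡.refl = ∙-cancelʳ _ _ _ (trans sum≈ (+-congˡ (sym (sumUpTo-congBelow K below))))
    where
    below : ∀ k → k ≤ K → h k ≈ h′ k
    below k k≤K = off k (λ k≡r → <-irrefl k≡r (s≤s k≤K))
  ... | no r≢K = sumUpTo-cancel K r (≤-pred (≤∧≢⇒< r≤K r≢K))
                   (∙-cancelˡ _ _ _ (trans (+-congʳ (sym (off (suc K) (r≢K ∘ ≡.sym)))) sum≈)) off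

  sumBox-single : ∀ n B α {h : Mono n → Carrier} → (∀ β → β ≢ α → h β ≈ 0#) →
                  (∀ i → lookup α i ≤ B) → sumBox n B h ≈ h α
  sumBox-single zero    B []      off _    = refl
  sumBox-single (suc n) B (a ∷ α) {h} off inBox = begin
    sumUpTo B (λ k → sumBox n B (λ β → h (k ∷ β)))
      ≈⟨ sumUpTo-single B a (λ k k≢a → sum-of-zeros (sumBox-linear n B) (λ β → off (k ∷ β) (k≢a ∘ ∷-injectiveˡ)))
                            (inBox zero) ⟩
    sumBox n B (λ β → h (a ∷ β))
      ≈⟨ sumBox-single n B α (λ β β≢α → off (a ∷ β) (β≢α ∘ ∷-injectiveʳ)) (inBox ∘ suc) ⟩
    h (a ∷ α) ∎

  H-on : ∀ {n} i (p : Coeffs n) β → ∣ β ∣ₘ ≡ i → H i p β ≈ p β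
  H-on i p β ∣β∣≡i with ∣ β ∣ₘ ≟ i
  ... | yes _     = refl
  ... | no ∣β∣≢i = contradiction ∣β∣≡i ∣β∣≢i

  H-off : ∀ {n} i (p : Coeffs n) β → ∣ β ∣ₘ ≢ i → H i p β ≈ 0#
  H-off i p β ∣β∣≢i with ∣ β ∣ₘ ≟ i
  ... | yes ∣β∣≡i = contradiction ∣β∣≡i ∣β∣≢i
  ... | no _      = refl

  H-*-cong : ∀ {n} i (p : Coeffs n) β {x y} → (∣ β ∣ₘ ≡ i → x ≈ y) → H i p β * x ≈ H i p β * y
  H-*-cong i p β x≈y with ∣ β ∣ₘ ≟ i
  ... | yes ∣β∣≡i = *-congˡ (x≈y ∣β∣≡i)
  ... | no _      = trans (zeroˡ _) (sym (zeroˡ _))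

  H-*-zero : ∀ {n} i (p : Coeffs n) β {x} → (∣ β ∣ₘ ≡ i → p β * x ≈ 0#) → H i p β * x ≈ 0#
  H-*-zero i p β px≈0 with ∣ β ∣ₘ ≟ i
  ... | yes ∣β∣≡i = px≈0 ∣β∣≡i
  ... | no _      = zeroˡ _

  _≈[≥_]_ : ∀ {n} → Coeffs n → ℕ → Coeffs n → Set ℓ
  p ≈[≥ m ] q = ∀ β → m ≤ ∣ β ∣ₘ → p β ≈ q β

  ≈[≥]-weaken : ∀ {n m} {p q : Coeffs n} → p ≈[≥ m ] q → p ≈[≥ suc m ] q
  ≈[≥]-weaken p≈q β m<∣β∣ = p≈q β (<⇒≤ m<∣β∣)

  D-congAt : ∀ {n} e {p q : Coeffs n} α → (∀ β → ∣ β ∣ₘ ≡ suc ∣ α ∣ₘ → p β ≈ q β) →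
             D¹ e p α ≈ D¹ e q α
  D-congAt {n} e α p≈q = cong (sumFin-linear n) (λ t → *-congˡ (*-congˡ (p≈q _ (∣inc∣ α t))))

  D-cong : ∀ {n} e {p q : Coeffs n} → (∀ β → p β ≈ q β) → ∀ α → D¹ e p α ≈ D¹ e q α
  D-cong e p≈q α = D-congAt e α (λ β _ → p≈q β)

  D-agree : ∀ {n} e {m} {p q : Coeffs n} → p ≈[≥ suc m ] q → D¹ e p ≈[≥ m ] D¹ e q
  D-agree e p≈q α m≤∣α∣ = D-congAt e α (λ β ∣β∣≡ → p≈q β (≡.subst (_ ≤_) (≡.sym ∣β∣≡) (s≤s m≤∣α∣)))

  D-zero : ∀ {n} e (α : Mono n) → D¹ e (λ _ → 0#) α ≈ 0#
  D-zero {n} e α = sum-of-zeros (sumFin-linear n) (λ t → trans (*-congˡ (zeroʳ _)) (zeroʳ _))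

  D-homogeneous-on : ∀ {n} e i (p : Coeffs n) α → suc ∣ α ∣ₘ ≡ i → D¹ e (H i p) α ≈ D¹ e p α
  D-homogeneous-on e i p α deg≡ =
    D-congAt e α (λ β ∣β∣≡ → H-on i p β (≡.trans ∣β∣≡ deg≡))

  D-homogeneous-off : ∀ {n} e i (p : Coeffs n) α → suc ∣ α ∣ₘ ≢ i → D¹ e (H i p) α ≈ 0#
  D-homogeneous-off e i p α deg≢ =
    trans (D-congAt e α (λ β ∣β∣≡ → H-off i p β (deg≢ ∘ ≡.trans (≡.sym ∣β∣≡)))) (D-zero e α)

  D-scale : ∀ {n} e x (p : Coeffs n) α → D¹ e (λ β → x * p β) α ≈ x * D¹ e p α
  D-scale {n} e x p α = trans (cong (sumFin-linear n) (λ t → pull-out x _ _ _))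
                              (scalar (sumFin-linear n) x _)

  D-sum : ∀ {n a} {A : Set a} {S} → IsLinearSum {A = A} S → ∀ e (h : A → Carrier)
          (K : Mono n → A → Carrier) α →
          D¹ e (λ γ → S (λ i → h i * K γ i)) α ≈ S (λ i → h i * D¹ e (λ γ → K γ i) α)
  D-sum {n} {S = S} L e h K α = begin
    sumFin n (λ t → lookup e t * (ι (suc (lookup α t)) * S (λ i → h i * K (α [ t ]%= suc) i)))
      ≈⟨ cong (sumFin-linear n) (λ t → trans (*-congˡ (sym (scalar L _ _))) (sym (scalar L _ _))) ⟩
    sumFin n (λ t → S (λ i → lookup e t * (ι (suc (lookup α t)) * (h i * K (α [ t ]%= suc) i))))
      ≈⟨ cong (sumFin-linear n) (λ t → cong L (λ i → pull-out (h i) _ _ _)) ⟩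
    sumFin n (λ t → S (λ i → h i * (lookup e t * (ι (suc (lookup α t)) * K (α [ t ]%= suc) i))))
      ≈⟨ sumFin-swap L n _ ⟩
    S (λ i → sumFin n (λ t → h i * (lookup e t * (ι (suc (lookup α t)) * K (α [ t ]%= suc) i))))
      ≈⟨ cong L (λ i → scalar (sumFin-linear n) (h i) _) ⟩
    S (λ i → h i * D¹ e (λ γ → K γ i) α) ∎

  -- Directional derivatives commute (symmetry of mixed partial derivatives).
  D-comm : ∀ {n} a b (p : Coeffs n) α → D¹ a (D¹ b p) α ≈ D¹ b (D¹ a p) α
  D-comm {n} a b p α = begin
    D¹ a (D¹ b p) α
      ≈⟨ expand a b ⟩
    sumFin n (λ t → sumFin n (λ s → (lookup a t * lookup b s) * W t s))
      ≈⟨ sumFin-swap (sumFin-linear n) n _ ⟩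
    sumFin n (λ s → sumFin n (λ t → (lookup a t * lookup b s) * W t s))
      ≈⟨ cong (sumFin-linear n) (λ s → cong (sumFin-linear n) (λ t → *-cong (*-comm _ _) (W-sym t s))) ⟩
    sumFin n (λ s → sumFin n (λ t → (lookup b s * lookup a t) * W s t))
      ≈⟨ sym (expand b a) ⟩
    D¹ b (D¹ a p) α ∎
    where
    W : Fin n → Fin n → Carrier
    W t s = ι (suc (lookup α t)) * (ι (suc (lookup (α [ t ]%= suc) s)) * p ((α [ t ]%= suc) [ s ]%= suc))

    expand : ∀ a b → D¹ a (D¹ b p) α ≈ sumFin n (λ t → sumFin n (λ s → (lookup a t * lookup b s) * W t s))
    expand a b = cong (sumFin-linear n) (λ t →
      trans (*-congˡ (sym (scalar (sumFin-linear n) _ _)))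
            (trans (sym (scalar (sumFin-linear n) _ _))
                   (cong (sumFin-linear n) (λ s → trans (*-congˡ (x∙yz≈y∙xz _ _ _)) (sym (*-assoc _ _ _))))))

    W-sym : ∀ t s → W t s ≈ W s t
    W-sym t s with t Fin.≟ s
    ... | yes ≡.refl = refl
    ... | no t≢s = begin
      W t s
        ≈⟨ *-congˡ (*-cong (reflexive (≡.cong (ι ∘ suc) (lookup∘updateAt′ s t (t≢s ∘ ≡.sym) α)))
                           (reflexive (≡.cong p (updateAt-commutes s t (t≢s ∘ ≡.sym) α)))) ⟩
      ι (suc (lookup α t)) * (ι (suc (lookup α s)) * p ((α [ s ]%= suc) [ t ]%= suc))
        ≈⟨ x∙yz≈y∙xz _ _ _ ⟩
      ι (suc (lookup α s)) * (ι (suc (lookup α t)) * p ((α [ s ]%= suc) [ t ]%= suc))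
        ≈⟨ *-congˡ (*-congʳ (reflexive (≡.cong (ι ∘ suc) (≡.sym (lookup∘updateAt′ t s t≢s α))))) ⟩
      W s t ∎

  -- Coefficient of y^a in (y + x)^m, namely C(m,a)·x^(m-a).
  binomCoeff : Carrier → ℕ → ℕ → Carrier
  binomCoeff x m a = ι (m C a) * pow x (m ∸ a)

  -- Coefficient of x^α in Π_i (x_i + b_i)^{β_i}, so that
  -- shiftCoeff f b α = Σ_β f_β · kernel α β b.
  kernel : ∀ {n} → Mono n → Mono n → Vec Carrier n → Carrier
  kernel {n} α β b = prodFin n (λ i → binomCoeff (lookup b i) (lookup β i) (lookup α i))

  binom-below : ∀ x {m a} → m < a → binomCoeff x m a ≈ 0#
  binom-below x m<a = trans (*-congʳ (reflexive (≡.cong ι (k>n⇒nCk≡0 m<a)))) (zeroˡ _)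

  binom-diag : ∀ x m → binomCoeff x m m ≈ 1#
  binom-diag x m rewrite nCn≡1 m | n∸n≡0 m = trans (*-identityʳ _) ι-one

  -- x · C(m,a+1) x^(m-a-1) = C(m,a+1) x^(m-a), also when a ≥ m.
  binom-raise : ∀ x m a → x * binomCoeff x m (suc a) ≈ ι (m C suc a) * pow x (m ∸ a)
  binom-raise x m a with a <? m
  ... | yes a<m = trans (x∙yz≈y∙xz x _ _)
                        (reflexive (≡.cong (λ k → ι (m C suc a) * pow x k) (≡.sym (+-∸-assoc 1 a<m))))
  ... | no a≮m = begin
    x * binomCoeff x m (suc a)        ≈⟨ *-congˡ (binom-below x a+1>m) ⟩
    x * 0#                            ≈⟨ zeroʳ x ⟩
    0#                                ≈⟨ sym (zeroˡ _) ⟩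
    0# * pow x (m ∸ a)                ≈⟨ *-congʳ (reflexive (≡.cong ι (≡.sym (k>n⇒nCk≡0 a+1>m)))) ⟩
    ι (m C suc a) * pow x (m ∸ a)     ∎
    where
    a+1>m : m < suc a
    a+1>m = s≤s (≮⇒≥ a≮m)

  -- One-variable Euler identity: a·c_a + x·(a+1)·c_{a+1} = m·c_a for the
  -- coefficients c_a of (y + x)^m.
  binom-euler : ∀ x m a →
    ι a * binomCoeff x m a + x * (ι (suc a) * binomCoeff x m (suc a)) ≈ ι m * binomCoeff x m a
  binom-euler x m a = begin
    ι a * (ι (m C a) * P) + x * (ι (suc a) * binomCoeff x m (suc a))
      ≈⟨ +-congˡ (trans (x∙yz≈y∙xz _ _ _) (*-congˡ (binom-raise x m a))) ⟩
    ι a * (ι (m C a) * P) + ι (suc a) * (ι (m C suc a) * P)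
      ≈⟨ sym (trans (distribʳ P _ _) (+-cong (*-assoc _ _ _) (*-assoc _ _ _))) ⟩
    (ι a * ι (m C a) + ι (suc a) * ι (m C suc a)) * P
      ≈⟨ *-congʳ (sym (trans (ι-+ (a *ℕ (m C a)) (suc a *ℕ (m C suc a))) (+-cong (ι-* a (m C a)) (ι-* (suc a) (m C suc a))))) ⟩
    ι (a *ℕ (m C a) +ℕ suc a *ℕ (m C suc a)) * P
      ≈⟨ *-congʳ (reflexive (≡.cong ι (absorption m a))) ⟩
    ι (m *ℕ (m C a)) * P
      ≈⟨ trans (*-congʳ (ι-* m (m C a))) (*-assoc _ _ _) ⟩
    ι m * (ι (m C a) * P) ∎
    where
    P : Carrier
    P = pow x (m ∸ a)

  kernel-below : ∀ {n} (α β : Mono n) b → ∣ β ∣ₘ < ∣ α ∣ₘ → kernel α β b ≈ 0#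
  kernel-below (a ∷ α) (m ∷ β) (x ∷ b) lt with m <? a
  ... | yes m<a = trans (*-congʳ (binom-below x m<a)) (zeroˡ _)
  ... | no m≮a  = trans (*-congˡ (kernel-below α β b (tail-< lt (≮⇒≥ m≮a)))) (zeroʳ _)

  kernel-diag : ∀ {n} (α : Mono n) b → kernel α α b ≈ 1#
  kernel-diag []      []      = refl
  kernel-diag (a ∷ α) (x ∷ b) = trans (*-cong (binom-diag x a) (kernel-diag α b)) (*-identityˡ 1#)

  kernel-offdiag : ∀ {n} (α β : Mono n) b → ∣ β ∣ₘ ≡ ∣ α ∣ₘ → β ≢ α → kernel α β b ≈ 0#
  kernel-offdiag []      []      []      _ β≢α = contradiction ≡.refl β≢α
  kernel-offdiag (a ∷ α) (m ∷ β) (x ∷ b) e β≢α with <-cmp m a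
  ... | tri< m<a _ _    = trans (*-congʳ (binom-below x m<a)) (zeroˡ _)
  ... | tri≈ _ ≡.refl _ =
    trans (*-congˡ (kernel-offdiag α β b (+-cancelˡ-≡ m _ _ e) (β≢α ∘ ≡.cong (m ∷_)))) (zeroʳ _)
  ... | tri> _ _ a<m    = trans (*-congˡ (kernel-below α β b (tail-≡ e a<m))) (zeroʳ _)

  kernel-euler : ∀ {n} (α β : Mono n) b →
    ι ∣ α ∣ₘ * kernel α β b + D¹ b (λ γ → kernel γ β b) α ≈ ι ∣ β ∣ₘ * kernel α β b
  kernel-euler []      []      []      = +-identityʳ _
  kernel-euler {suc n} (a ∷ α) (m ∷ β) (x ∷ b) = begin
    ι (a +ℕ ∣ α ∣ₘ) * (G * K) + (x * (ι (suc a) * (G′ * K)) + Σtail)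
      ≈⟨ +-cong (*-congʳ (ι-+ a ∣ α ∣ₘ)) (+-congˡ Σtail≈) ⟩
    (ι a + ι ∣ α ∣ₘ) * (G * K) + (x * (ι (suc a) * (G′ * K)) + G * Dtail)
      ≈⟨ regroup (ι a) (ι ∣ α ∣ₘ) G K x (ι (suc a)) G′ Dtail ⟩
    (ι a * G + x * (ι (suc a) * G′)) * K + G * (ι ∣ α ∣ₘ * K + Dtail)
      ≈⟨ +-cong (*-congʳ (binom-euler x m a)) (*-congˡ (kernel-euler α β b)) ⟩
    (ι m * G) * K + G * (ι ∣ β ∣ₘ * K)
      ≈⟨ collect (ι m) (ι ∣ β ∣ₘ) G K ⟩
    (ι m + ι ∣ β ∣ₘ) * (G * K)
      ≈⟨ *-congʳ (sym (ι-+ m ∣ β ∣ₘ)) ⟩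
    ι (m +ℕ ∣ β ∣ₘ) * (G * K) ∎
    where
    G G′ K Dtail Σtail : Carrier
    G  = binomCoeff x m a
    G′ = binomCoeff x m (suc a)
    K  = kernel α β b
    Dtail = D¹ b (λ γ → kernel γ β b) α
    Σtail = sumFin n (λ t → lookup b t * (ι (suc (lookup α t)) * (G * kernel (α [ t ]%= suc) β b)))
    Σtail≈ : Σtail ≈ G * Dtail
    Σtail≈ = trans (cong (sumFin-linear n) (λ t → pull-out G _ _ _)) (scalar (sumFin-linear n) G _)
    regroup : ∀ A B G K X I G′ D →
      (A + B) * (G * K) + (X * (I * (G′ * K)) + G * D) ≈ (A * G + X * (I * G′)) * K + G * (B * K + D)
    regroup = solve 8 (λ A B G K X I G′ D →
      ((A :+ B) :* (G :* K)) :+ ((X :* (I :* (G′ :* K))) :+ (G :* D))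
        := ((((A :* G) :+ (X :* (I :* G′))) :* K) :+ (G :* ((B :* K) :+ D)))) refl
    collect : ∀ M N G K → (M * G) * K + G * (N * K) ≈ (M + N) * (G * K)
    collect = solve 4 (λ M N G K → (((M :* G) :* K) :+ (G :* (N :* K))) := ((M :+ N) :* (G :* K))) refl

  kernel-derivative : ∀ {n} (α β : Mono n) b j → ∣ β ∣ₘ ≡ ∣ α ∣ₘ +ℕ j →
                      D¹ b (λ γ → kernel γ β b) α ≈ ι j * kernel α β b
  kernel-derivative α β b j ∣β∣≡ = ∙-cancelˡ (ι ∣ α ∣ₘ * K) _ _ (begin
    ι ∣ α ∣ₘ * K + D¹ b (λ γ → kernel γ β b) α   ≈⟨ kernel-euler α β b ⟩
    ι ∣ β ∣ₘ * K                                 ≈⟨ *-congʳ (trans (reflexive (≡.cong ι ∣β∣≡)) (ι-+ ∣ α ∣ₘ j)) ⟩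
    (ι ∣ α ∣ₘ + ι j) * K                         ≈⟨ distribʳ K _ _ ⟩
    ι ∣ α ∣ₘ * K + ι j * K                       ∎)
    where
    K : Carrier
    K = kernel α β b

  module Taylor {n} (f : Poly n) where

    private
      B : ℕ
      B = bound f

      Σβ : (Mono n → Carrier) → Carrier
      Σβ = sumBox n B

      Σβ-linear : IsLinearSum Σβ
      Σβ-linear = sumBox-linear n B

    -- Coefficient of x^α in the part of f(x + b) that is homogeneous of
    -- degree k in b; it only involves the terms of f of degree ∣α∣ + k.
    part : Vec Carrier n → ℕ → Coeffs n
    part b k α = Σβ (λ β → H (∣ α ∣ₘ +ℕ k) (coeff f) β * kernel α β b)

    expansion : ∀ b K α → B ≤ K → shiftCoeff f b α ≈ sumUpTo K (λ k → part b k α)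
    expansion b K α B≤K =
      sym (trans (sumUpTo-swap Σβ-linear K _) (cong Σβ-linear resum))
      where
      term : ℕ → Mono n → Carrier
      term k β = H (∣ α ∣ₘ +ℕ k) (coeff f) β * kernel α β b

      negligible : ∀ β → coeff f β * kernel α β b ≈ 0# →
                   sumUpTo K (λ k → term k β) ≈ coeff f β * kernel α β b
      negligible β fK≈0 =
        trans (sum-of-zeros (sumUpTo-linear K) (λ k → H-*-zero _ _ β (λ _ → fK≈0))) (sym fK≈0)

      -- only k = ∣β∣ - ∣α∣ contributes
      resum : ∀ β → sumUpTo K (λ k → term k β) ≈ coeff f β * kernel α β b
      resum β with ∣ α ∣ₘ ≤? ∣ β ∣ₘ | ∣ β ∣ₘ ∸ ∣ α ∣ₘ ≤? K
      ... | no α≰β | _ =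
        negligible β (trans (*-congˡ (kernel-below α β b (≰⇒> α≰β))) (zeroʳ _))
      ... | yes α≤β | no j≰K =
        negligible β (trans (*-congʳ (vanish f β B<∣β∣)) (zeroˡ _))
        where
        B<∣β∣ : B < ∣ β ∣ₘ
        B<∣β∣ = ≤-<-trans B≤K (<-≤-trans (≰⇒> j≰K) (m∸n≤m ∣ β ∣ₘ ∣ α ∣ₘ))
      ... | yes α≤β | yes j≤K =
        trans (sumUpTo-single K (∣ β ∣ₘ ∸ ∣ α ∣ₘ) other j≤K)
              (*-congʳ (H-on _ (coeff f) β (≡.sym (m+[n∸m]≡n α≤β))))
        where
        other : ∀ k → k ≢ ∣ β ∣ₘ ∸ ∣ α ∣ₘ → term k β ≈ 0#
        other k k≢j = H-*-zero _ _ β (λ ∣β∣≡ →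
          contradiction (≡.trans (≡.sym (m+n∸m≡n ∣ α ∣ₘ k)) (≡.cong (_∸ ∣ α ∣ₘ) (≡.sym ∣β∣≡))) k≢j)

    part-zero : ∀ b α → part b 0 α ≈ coeff f α
    part-zero b α with ∣ α ∣ₘ ≤? B
    ... | yes ∣α∣≤B = begin
      part b 0 α
        ≈⟨ sumBox-single n B α off (λ i → ≤-trans (lookup≤∣∣ α i) ∣α∣≤B) ⟩
      H (∣ α ∣ₘ +ℕ 0) (coeff f) α * kernel α α b
        ≈⟨ *-cong (H-on _ (coeff f) α (≡.sym (ℕₚ.+-identityʳ ∣ α ∣ₘ))) (kernel-diag α b) ⟩
      coeff f α * 1#
        ≈⟨ *-identityʳ _ ⟩
      coeff f α ∎
      where
      off : ∀ β → β ≢ α → H (∣ α ∣ₘ +ℕ 0) (coeff f) β * kernel α β b ≈ 0#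
      off β β≢α = H-*-zero _ _ β (λ ∣β∣≡ →
        trans (*-congˡ (kernel-offdiag α β b (≡.trans ∣β∣≡ (ℕₚ.+-identityʳ ∣ α ∣ₘ)) β≢α)) (zeroʳ _))
    ... | no ∣α∣≰B =
      trans (sum-of-zeros Σβ-linear (λ β → H-*-zero _ _ β (λ ∣β∣≡ →
               trans (*-congʳ (vanish f β (≡.subst (B <_) (≡.sym (≡.trans ∣β∣≡ (ℕₚ.+-identityʳ _))) B<∣α∣)))
                     (zeroˡ _))))
            (sym (vanish f α B<∣α∣))
      where
      B<∣α∣ : B < ∣ α ∣ₘ
      B<∣α∣ = ≰⇒> ∣α∣≰B

    part-suc : ∀ b k α → ι (suc k) * part b (suc k) α ≈ D¹ b (part b k) α
    part-suc b k α = begin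
      ι (suc k) * Σβ (λ β → h β * kernel α β b)
        ≈⟨ sym (scalar Σβ-linear _ _) ⟩
      Σβ (λ β → ι (suc k) * (h β * kernel α β b))
        ≈⟨ cong Σβ-linear (λ β → trans (x∙yz≈y∙xz _ _ _)
                                       (H-*-cong _ _ β (sym ∘ kernel-derivative α β b (suc k)))) ⟩
      Σβ (λ β → h β * D¹ b (λ γ → kernel γ β b) α)
        ≈⟨ sym (D-sum Σβ-linear b h (λ γ β → kernel γ β b) α) ⟩
      D¹ b (λ γ → Σβ (λ β → h β * kernel γ β b)) α
        ≈⟨ D-congAt b α (λ γ ∣γ∣≡ → reflexive (≡.cong (λ i → Σβ (λ β → H i (coeff f) β * kernel γ β b))
                                                         (degree γ ∣γ∣≡))) ⟩
      D¹ b (part b k) α ∎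
      where
      h : Mono n → Carrier
      h = H (∣ α ∣ₘ +ℕ suc k) (coeff f)
      degree : ∀ γ → ∣ γ ∣ₘ ≡ suc ∣ α ∣ₘ → ∣ α ∣ₘ +ℕ suc k ≡ ∣ γ ∣ₘ +ℕ k
      degree γ ∣γ∣≡ = ≡.trans (+-suc ∣ α ∣ₘ k) (≡.cong (_+ℕ k) (≡.sym ∣γ∣≡))

    part-one : ∀ b α → part b 1 α ≈ D¹ b (coeff f) α
    part-one b α = begin
      part b 1 α                ≈⟨ sym (trans (*-congʳ ι-one) (*-identityˡ _)) ⟩
      ι 1 * part b 1 α          ≈⟨ part-suc b 0 α ⟩
      D¹ b (part b 0) α         ≈⟨ D-cong b (part-zero b) α ⟩
      D¹ b (coeff f) α          ∎

    part-vanish : ∀ {d} → coeff f ≈[≥ suc d ] (λ _ → 0#) → ∀ b k α → d < k → part b k α ≈ 0#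
    part-vanish {d} deg b k α d<k = sum-of-zeros Σβ-linear (λ β → H-*-zero _ _ β (λ ∣β∣≡ →
      trans (*-congʳ (deg β (≡.subst (suc d ≤_) (≡.sym ∣β∣≡) (≤-trans d<k (m≤n+m k ∣ α ∣ₘ))))) (zeroˡ _)))

  module Bounded {n} (f : Poly n) {d} (deg : coeff f ≈[≥ suc d ] (λ _ → 0#)) where

    derivative-vanish : ∀ e α → d ≤ ∣ α ∣ₘ → D¹ e (coeff f) α ≈ 0#
    derivative-vanish e α d≤∣α∣ = trans (D-agree e deg α d≤∣α∣) (D-zero e α)

    derivative⇔components : ∀ a b →
      (f¹ f a ≡ᶜ f¹ f b) ⇔ (∀ i → i ≤ d → f¹[ i ] f b ≡ᶜ f¹[ i ] f a)
    derivative⇔components a b = mk⇔ to from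
      where
      to : f¹ f a ≡ᶜ f¹ f b → ∀ i → i ≤ d → f¹[ i ] f b ≡ᶜ f¹[ i ] f a
      to h i _ α with suc ∣ α ∣ₘ ≟ i
      ... | yes deg≡ = trans (D-homogeneous-on b i (coeff f) α deg≡)
                             (trans (sym (h α)) (sym (D-homogeneous-on a i (coeff f) α deg≡)))
      ... | no deg≢  = trans (D-homogeneous-off b i (coeff f) α deg≢)
                             (sym (D-homogeneous-off a i (coeff f) α deg≢))
      from : (∀ i → i ≤ d → f¹[ i ] f b ≡ᶜ f¹[ i ] f a) → f¹ f a ≡ᶜ f¹ f b
      from h α with suc ∣ α ∣ₘ ≤? d
      ... | yes ∣α∣<d = trans (sym (D-homogeneous-on a _ (coeff f) α ≡.refl))
                              (trans (sym (h _ ∣α∣<d α)) (D-homogeneous-on b _ (coeff f) α ≡.refl))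
      ... | no ∣α∣≮d  = trans (derivative-vanish a α d≤∣α∣) (sym (derivative-vanish b α d≤∣α∣))
        where
        d≤∣α∣ : d ≤ ∣ α ∣ₘ
        d≤∣α∣ = ≤-pred (≰⇒> ∣α∣≮d)

  module Rigidity {n} (f : Poly n) {d} (deg : coeff f ≈[≥ suc d ] (λ _ → 0#))
                  (char : CharZero ⊎ CharGreaterThan d) (a b : Vec Carrier n) where
    open Taylor f
    open Bounded f deg using (derivative-vanish)

    -- A statement about P_{k+1} may be divided by k + 1: for k + 1 ≤ d this
    -- is invertible, and beyond d the statement is to be proved directly.
    divide : ∀ k {x y} → (suc k ≤ d → ι (suc k) * x ≈ ι (suc k) * y) → (d < suc k → x ≈ y) → x ≈ y
    divide k scaled beyond with suc k ≤? d
    ... | yes k<d = *-cancelˡ-nonzero (ι-nonzero char k k<d) (scaled k<d)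
    ... | no k≮d  = beyond (≰⇒> k≮d)

    D-part-vanish : ∀ e e′ k α → d < k → D¹ e (part e′ k) α ≈ 0#
    D-part-vanish e e′ k α d<k = trans (D-cong e (λ β → part-vanish deg e′ k β d<k) α) (D-zero e α)

    derivative-step : ∀ {m} k → D¹ b (part a k) ≈[≥ suc m ] D¹ a (part a k) →
                      D¹ b (part a (suc k)) ≈[≥ m ] D¹ a (part a (suc k))
    derivative-step k agree α m≤∣α∣ = divide k
      (λ _ → begin
        ι (suc k) * D¹ b (part a (suc k)) α   ≈⟨ scaled b ⟩
        D¹ b (D¹ a (part a k)) α              ≈⟨ D-comm b a (part a k) α ⟩
        D¹ a (D¹ b (part a k)) α              ≈⟨ D-agree a agree α m≤∣α∣ ⟩
        D¹ a (D¹ a (part a k)) α              ≈⟨ sym (scaled a) ⟩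
        ι (suc k) * D¹ a (part a (suc k)) α   ∎)
      (λ d<k → trans (D-part-vanish b a (suc k) α d<k) (sym (D-part-vanish a a (suc k) α d<k)))
      where
      scaled : ∀ e → ι (suc k) * D¹ e (part a (suc k)) α ≈ D¹ e (D¹ a (part a k)) α
      scaled e = trans (sym (D-scale e (ι (suc k)) (part a (suc k)) α)) (D-cong e (part-suc a k) α)

    part-step : ∀ {m} k → part b k ≈[≥ suc m ] part a k →
                D¹ b (part a k) ≈[≥ m ] D¹ a (part a k) →
                part b (suc k) ≈[≥ m ] part a (suc k)
    part-step k parts derivatives α m≤∣α∣ = divide k
      (λ _ → begin
        ι (suc k) * part b (suc k) α   ≈⟨ part-suc b k α ⟩
        D¹ b (part b k) α              ≈⟨ D-agree b parts α m≤∣α∣ ⟩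
        D¹ b (part a k) α              ≈⟨ derivatives α m≤∣α∣ ⟩
        D¹ a (part a k) α              ≈⟨ sym (part-suc a k α) ⟩
        ι (suc k) * part a (suc k) α   ∎)
      (λ d<k → trans (part-vanish deg b (suc k) α d<k) (sym (part-vanish deg a (suc k) α d<k)))

    module _ {m} (agree : D¹ a (coeff f) ≈[≥ m ] D¹ b (coeff f)) where

      derivatives-agree : ∀ k → D¹ b (part a k) ≈[≥ m ] D¹ a (part a k)
      derivatives-agree zero α m≤∣α∣ = begin
        D¹ b (part a 0) α    ≈⟨ D-cong b (part-zero a) α ⟩
        D¹ b (coeff f) α     ≈⟨ sym (agree α m≤∣α∣) ⟩
        D¹ a (coeff f) α     ≈⟨ sym (D-cong a (part-zero a) α) ⟩
        D¹ a (part a 0) α    ∎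
      derivatives-agree (suc k) = derivative-step k (≈[≥]-weaken (derivatives-agree k))

      parts-agree : ∀ k → part b k ≈[≥ m ] part a k
      parts-agree zero    α _ = trans (part-zero b α) (sym (part-zero a α))
      parts-agree (suc k)     = part-step k (≈[≥]-weaken (parts-agree k)) (derivatives-agree k)

    -- Equal translates: agreement of D_a f and D_b f in degrees > m extends
    -- to degree m, since in degree m every other Taylor part agrees.
    lower-threshold : (∀ α → shiftCoeff f b α ≈ shiftCoeff f a α) → ∀ m →
      D¹ a (coeff f) ≈[≥ suc m ] D¹ b (coeff f) → D¹ a (coeff f) ≈[≥ m ] D¹ b (coeff f)
    lower-threshold same m agree α m≤∣α∣ = begin
      D¹ a (coeff f) α   ≈⟨ sym (part-one a α) ⟩
      part a 1 α         ≈⟨ sym (sumUpTo-cancel K 1 (s≤s z≤n) sums others) ⟩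
      part b 1 α         ≈⟨ part-one b α ⟩
      D¹ b (coeff f) α   ∎
      where
      K : ℕ
      K = suc (bound f)
      sums : sumUpTo K (λ k → part b k α) ≈ sumUpTo K (λ k → part a k α)
      sums = trans (sym (expansion b K α (n≤1+n _))) (trans (same α) (expansion a K α (n≤1+n _)))
      others : ∀ k → k ≢ 1 → part b k α ≈ part a k α
      others zero          _   = trans (part-zero b α) (sym (part-zero a α))
      others (suc zero)    1≢1 = contradiction ≡.refl 1≢1
      others (suc (suc k)) _   =
        part-step (suc k) (parts-agree agree (suc k)) (derivative-step k (derivatives-agree agree k)) α m≤∣α∣

    translate⇒derivative : (∀ α → shiftCoeff f b α ≈ shiftCoeff f a α) → f¹ f a ≡ᶜ f¹ f b
    translate⇒derivative same α = from-threshold 0 d ≤-refl α z≤n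
      where
      -- downward induction on the threshold, starting at d
      from-threshold : ∀ m j → d ≤ m +ℕ j → D¹ a (coeff f) ≈[≥ m ] D¹ b (coeff f)
      from-threshold m zero d≤m β m≤∣β∣ =
        trans (derivative-vanish a β d≤∣β∣) (sym (derivative-vanish b β d≤∣β∣))
        where
        d≤∣β∣ : d ≤ ∣ β ∣ₘ
        d≤∣β∣ = ≤-trans (≡.subst (d ≤_) (ℕₚ.+-identityʳ m) d≤m) m≤∣β∣
      from-threshold m (suc j) d≤m+j =
        lower-threshold same m (from-threshold (suc m) j (≡.subst (d ≤_) (+-suc m j) d≤m+j))

    derivative⇒translate : f¹ f a ≡ᶜ f¹ f b → ∀ α → shiftCoeff f b α ≈ shiftCoeff f a α
    derivative⇒translate same-derivative α = begin
      shiftCoeff f b α               ≈⟨ expansion b (bound f) α ≤-refl ⟩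
      sumUpTo (bound f) (λ k → part b k α)
        ≈⟨ cong (sumUpTo-linear (bound f)) (λ k → parts-agree {0} (λ β _ → same-derivative β) k α z≤n) ⟩
      sumUpTo (bound f) (λ k → part a k α)
        ≈⟨ sym (expansion a (bound f) α ≤-refl) ⟩
      shiftCoeff f a α               ∎

lemma4p7 : ∀ {c ℓ} (F : Field c ℓ) → let open PolyDefs F in
    ∀ (n : ℕ) (f g : Poly n) (d : ℕ) → HasDegree f d →
    (CharZero ⊎ CharGreaterThan d) →
    ∀ (a b : Vec Carrier n) → a ∈S[ f , g ] →
    (b ∈S[ f , g ] ⇔ (f¹ f a ≡ᶜ f¹ f b))
    × (b ∈S[ f , g ] ⇔ (∀ i → i ≤ d → f¹[ i ] f b ≡ᶜ f¹[ i ] f a))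
lemma4p7 F n f g d (deg , _) char a b a∈S =
  translates , ⇔.trans translates (Bounded.derivative⇔components f deg a b)
  where
  open PolyDefs F
  open Theory F using (module Bounded; module Rigidity)
  open Rigidity f deg char a b using (translate⇒derivative; derivative⇒translate)

  translates : b ∈S[ f , g ] ⇔ (f¹ f a ≡ᶜ f¹ f b)
  translates = mk⇔
    (λ b∈S → translate⇒derivative (λ α → trans (b∈S α) (sym (a∈S α))))
    (λ same-derivative α → trans (derivative⇒translate same-derivative α) (a∈S α))
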